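{- Let $\Delta\subseteq\mathbb{N}^d$ ($d\ge1$) be a finite standard set. Then the C4 decompositions of $\Delta$ and the standard decompositions of its standard graph $G(\Delta)$ are in canonical bijection.
   Context: A finite standard set is a finite $\Delta\subseteq\mathbb{N}^d$ whose complement $C$ satisfies $C+\mathbb{N}^d=C$. Let $q^d\colon\mathbb{N}^d\to\mathbb{N}^{d-1}$ forget the last coordinate, $q_d$ take the last coordinate, and $h_\Delta(\gamma)=|(q^d)^{ -1}(\gamma)\cap\Delta|$. The C4 sum of $\Delta_1,\Delta_2\subseteq\mathbb{N}^d$ is $\{\beta: q_d(\beta)<h_{\Delta_1}(q^d\beta)+h_{\Delta_2}(q^d\beta)\}$. A C4 decomposition of $\Delta$ is a finite multiset of finite standard sets in $\mathbb{N}^{d-1}$, embedded via $\gamma\mapsto(\gamma,0)$, whose C4 sum is $\Delta$. $G(\Delta)$ is the labeled graph with nodes $q^d(\Delta)$, edges $(\gamma+e_i,\gamma)$ whenever both lie in $q^d(\Delta)$ ($e_i$ standard basis of $\mathbb{N}^{d-1}$), and labels $h_\Delta(\gamma)$. For labeled graphs (finite nodes, loopless directed edges, integer labels $\ell$) with the same nodes and edges, $\oplus,\ominus$ add/subtract labels; a graph is standard if labels are $\ge0$ and $\ell(a)\le\ell(b)$ for each edge $(a,b)$. A standard component of $G$ is a labeled graph $H$ with the same nodes and edges, labels in $\{0,1\}$, $H$ and $G\ominus H$ standard, not all labels zero; a standard decomposition of $G$ is a finite multiset of standard components summing to $G$. -}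

module Defs where

open import Data.Bool using (Bool; true; false; T; _∧_; if_then_else_)
open import Data.Nat using (ℕ; zero; suc; _+_; _<ᵇ_; _≡ᵇ_; _⊔_)
open import Data.Fin using (Fin; _≟_)
open import Data.Integer as ℤ using (ℤ; +_; +0; +[1+_])
open import Data.Vec using (Vec; []; _∷_; init; last; _∷ʳ_; zipWith; tabulate)
open import Data.List using (List; []; _∷_; map; length; filterᵇ; upTo; foldr)
open import Data.List.Membership.Propositional using (_∈_)
open import Data.List.Relation.Binary.Pointwise using (Pointwise)
open import Data.List.Relation.Binary.Permutation.Homogeneous using (Permutation)
open import Data.Product using (Σ; ∃; _×_; proj₁; proj₂)
open import Data.Sum using (_⊎_)
open import Relation.Binary.PropositionalEquality using (_≡_; _≢_)
open import Relation.Nullary using (does)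

-- Points of ℕ^d are vectors  Vec ℕ d.  For d = suc n,
--   q^d = init  (forget the last coordinate),   q_d = last.

Subset : ℕ → Set
Subset d = Vec ℕ d → Bool

record FinSubset (d : ℕ) : Set where
  field
    mem    : Subset d
    cover  : List (Vec ℕ d)
    covers : ∀ x → T (mem x) → x ∈ cover
open FinSubset public

-- Standard: the complement C satisfies C + ℕ^d = C,
-- i.e. x ∉ Δ implies x + v ∉ Δ for every v ∈ ℕ^d.
IsStandard : ∀ {d} → Subset d → Set
IsStandard {d} S = ∀ (x v : Vec ℕ d) → S x ≡ false → S (zipWith _+_ x v) ≡ false

record FinStdSet (d : ℕ) : Set where
  field
    fin      : FinSubset d
    standard : IsStandard (mem fin)
open FinStdSet public

countBelow : (ℕ → Bool) → ℕ → ℕ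
countBelow P B = length (filterᵇ P (upTo B))

-- h_Δ(γ) = |(q^d)⁻¹(γ) ∩ Δ| for a subset S with covering list xs:
-- all t with (γ,t) ∈ S lie below 1 + max of last coordinates of xs.
hCount : ∀ {n} → Subset (suc n) → List (Vec ℕ (suc n)) → Vec ℕ n → ℕ
hCount S xs γ = countBelow (λ t → S (γ ∷ʳ t)) (suc (foldr (λ x m → last x ⊔ m) 0 xs))

h : ∀ {n} → FinSubset (suc n) → Vec ℕ n → ℕ
h Δ = hCount (mem Δ) (cover Δ)

-- The embedding γ ↦ (γ,0) of a finite subset of ℕ^n into ℕ^(n+1)
-- (only its membership function and covering list are needed for h).
embedMem : ∀ {n} → Subset n → Subset (suc n)
embedMem S v = S (init v) ∧ (last v ≡ᵇ 0)

hEmbed : ∀ {n} → FinStdSet n → Vec ℕ n → ℕ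
hEmbed D = hCount (embedMem (mem (fin D))) (map (_∷ʳ 0) (cover (fin D)))

-- Membership in the C4 sum of the (embedded) multiset Ds:
--   β ∈ ⊕ Ds  iff  q_d β < Σ_i h_{Δ_i}(q^d β)
-- (the C4 sum is associative/commutative with h additive, so the C4 sum
-- of a multiset is this set; the empty multiset gives ∅).
sumℕ : List ℕ → ℕ
sumℕ = foldr _+_ 0

c4SumMem : ∀ {n} → List (FinStdSet n) → Subset (suc n)
c4SumMem Ds β = last β <ᵇ sumℕ (map (λ D → hEmbed D (init β)) Ds)

NonEmpty : ∀ {n} → FinStdSet n → Set
NonEmpty D = ∃ λ x → T (mem (fin D) x)

-- A C4 decomposition of Δ: a finite multiset (list, up to permutation)
-- of nonempty finite standard sets in ℕ^n whose C4 sum is Δ.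
record C4Dec {n} (Δ : FinStdSet (suc n)) : Set where
  field
    parts    : List (FinStdSet n)
    nonempty : ∀ D → D ∈ parts → NonEmpty D
    sumIsΔ   : ∀ β → mem (fin Δ) β ≡ c4SumMem parts β
open C4Dec public

_≈S_ : ∀ {n} → FinStdSet n → FinStdSet n → Set
D ≈S D' = ∀ x → mem (fin D) x ≡ mem (fin D') x

_≈C4_ : ∀ {n} {Δ : FinStdSet (suc n)} → C4Dec Δ → C4Dec Δ → Set
A ≈C4 B = Permutation _≈S_ (parts A) (parts B)

e : ∀ {n} → Fin n → Vec ℕ n
e i = tabulate (λ j → if does (i ≟ j) then 1 else 0)

module _ {n : ℕ} (Δ : FinStdSet (suc n)) where

  Node : Vec ℕ n → Set
  Node γ = ∃ λ β → T (mem (fin Δ) β) × init β ≡ γ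

  Edge : Vec ℕ n → Vec ℕ n → Set
  Edge a b = Node a × Node b × ∃ λ (i : Fin n) → a ≡ zipWith _+_ b (e i)

  -- A labeled graph with the node/edge set of G(Δ) is given by its
  -- labeling (only values on nodes matter).
  Labels : Set
  Labels = Vec ℕ n → ℤ

  GΔ : Labels
  GΔ γ = + h (fin Δ) γ

  _⊖_ : Labels → Labels → Labels
  (ℓ ⊖ ℓ') γ = ℓ γ ℤ.- ℓ' γ

  IsStandardGraph : Labels → Set
  IsStandardGraph ℓ = (∀ a → Node a → +0 ℤ.≤ ℓ a)
                    × (∀ a b → Edge a b → ℓ a ℤ.≤ ℓ b)

  IsStdComponent : Labels → Set
  IsStdComponent ℓ = (∀ a → Node a → ℓ a ≡ +0 ⊎ ℓ a ≡ + 1)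
                   × IsStandardGraph ℓ
                   × IsStandardGraph (GΔ ⊖ ℓ)
                   × (∃ λ a → Node a × ℓ a ≢ +0)

  StdComponent : Set
  StdComponent = Σ Labels IsStdComponent

  sumℤ : List ℤ → ℤ
  sumℤ = foldr ℤ._+_ +0

  _≈L_ : Labels → Labels → Set
  ℓ ≈L ℓ' = ∀ a → Node a → ℓ a ≡ ℓ' a

  record StdDec : Set where
    field
      comps  : List StdComponent
      sumIsG : (λ a → sumℤ (map (λ H → proj₁ H a) comps)) ≈L GΔ
  open StdDec public

  _≈SC_ : StdComponent → StdComponent → Set
  H ≈SC H' = proj₁ H ≈L proj₁ H'

  _≈SD_ : StdDec → StdDec → Set
  A ≈SD B = Permutation _≈SC_ (comps A) (comps B)

  indicator : FinStdSet n → Labels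
  indicator D γ = if mem (fin D) γ then + 1 else +0

  IsCanonical : (C4Dec Δ → StdDec) → Set
  IsCanonical Φ = ∀ D → Pointwise _≈L_ (map proj₁ (comps (Φ D))) (map indicator (parts D))

module Submission where

-- Since Δ is finite and standard, its fibre over γ is the segment
-- [0, h_Δ(γ)), while an embedded set D × {0} has height 1 over D and 0
-- elsewhere.  Hence a list Ds is a C4 decomposition of Δ exactly when
-- h_Δ(γ) is the number of members of Ds containing γ (its multiplicity),
-- i.e. when the indicator labels of Ds add up to G(Δ).  Each ind D is then
-- a standard component: both ind D and G(Δ) ⊖ ind D (the multiplicity of
-- the remaining parts) are multiplicities of standard sets, so they do not
-- increase along edges.  Conversely, the support of a component (its nodes
-- labelled 1) is a finite standard set, since labels are 0/1 and do not
-- increase along edges.  Φ and the support map Ψ are mutually inverse and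
-- both respect permutations, which yields the four claims.

open import Defs
open import Data.Nat using (ℕ; suc)
open import Data.Product using (Σ; ∃; _×_)

open import Algebra.Properties.CommutativeSemigroup using (x∙yz≈y∙xz)
open import Data.Bool using (Bool; true; false; T; _∧_; if_then_else_)
open import Data.Bool.Properties using (T-≡; ¬-not; ∧-zeroʳ)
import Data.Fin as Fin
open import Data.Integer as ℤ using (ℤ; +_; +0; +≤+) renaming (_≤_ to _ℤ≤_)
open import Data.Integer.Properties using ([+m]-[+n]≡m⊖n; ⊖-≥; pos-+; +-injective)
open import Data.List using (List; []; _∷_; [_]; _++_; length; filterᵇ; upTo; foldr; map)
open import Data.List.Properties using (upTo-∷ʳ; length-++; filter-++)
open import Data.List.Membership.Propositional using (_∈_; _─_)
open import Data.List.Membership.Propositional.Properties using (∈-map⁺; ∈-map⁻)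
open import Data.List.Relation.Unary.Any using (here; there)
open import Data.List.Relation.Unary.All as All using (All; []; _∷_; reduce)
open import Data.List.Relation.Binary.Pointwise as Pointwise using (Pointwise; []; _∷_)
open import Data.List.Relation.Binary.Permutation.Homogeneous as Perm using (Permutation)
import Data.List.Relation.Binary.Permutation.Setoid.Properties as PermProperties
open import Data.Nat using (zero; _+_; _<ᵇ_; _⊔_; _≤_; _<_; z≤n; s≤s; _<?_)
open import Data.Nat.Properties
  using (+-comm; +-identityʳ; +-suc; +-mono-≤; +-commutativeSemigroup; m≤m+n; m+n∸m≡n;
         <⇒≤; ≤-refl; ≤-trans; ≤-antisym; ≮⇒≥; n≮0; n<1+n; m<n⇒m<1+n; m≤n⇒m<n∨m≡n;
         m≤m⊔n; m≤n⊔m; <ᵇ⇒<; <⇒<ᵇ)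
open import Data.Product using (_,_; proj₁)
open import Data.Sum using (_⊎_; inj₁; inj₂)
open import Data.Vec using (Vec; []; _∷_; init; last; _∷ʳ_; zipWith; tabulate; initLast)
open import Data.Vec.Properties using (init-∷ʳ; last-∷ʳ)
open import Function using (_∘_; Equivalence)
open import Relation.Binary using (Rel; Setoid; _Respects_)
open import Relation.Binary.PropositionalEquality
  using (_≡_; _≢_; refl; sym; trans; cong; cong₂; subst; subst₂; module ≡-Reasoning)
open import Relation.Nullary using (yes; no; contradiction)
open import Relation.Nullary.Decidable using (T?)
open import Relation.Unary using (Pred)

bit : Bool → ℕ
bit true  = 1
bit false = 0

bit≤1 : ∀ b → bit b ≤ 1
bit≤1 true  = s≤s z≤n
bit≤1 false = z≤n

∧-true : ∀ {x y} → x ∧ y ≡ true → x ≡ true × y ≡ true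
∧-true {true} y≡true = refl , y≡true

<ᵇ-true : ∀ {m n} → m < n → (m <ᵇ n) ≡ true
<ᵇ-true m<n = Equivalence.to T-≡ (<⇒<ᵇ m<n)

<ᵇ-false : ∀ {m n} → n ≤ m → (m <ᵇ n) ≡ false
<ᵇ-false {m} {zero}  _       = refl
<ᵇ-false {suc m} {suc n} (s≤s n≤m) = <ᵇ-false n≤m

<ᵇ-sound : ∀ {m n} → (m <ᵇ n) ≡ true → m < n
<ᵇ-sound {m} {n} eq = <ᵇ⇒< m n (Equivalence.from T-≡ eq)

countBelow-suc : ∀ P B → countBelow P (suc B) ≡ countBelow P B + bit (P B)
countBelow-suc P B = begin
  length (filterᵇ P (upTo (suc B)))                ≡⟨ cong (length ∘ filterᵇ P) (sym (upTo-∷ʳ B)) ⟩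
  length (filterᵇ P (upTo B ++ [ B ]))             ≡⟨ cong length (filter-++ (T? ∘ P) (upTo B) [ B ]) ⟩
  length (filterᵇ P (upTo B) ++ filterᵇ P [ B ])   ≡⟨ length-++ (filterᵇ P (upTo B)) ⟩
  countBelow P B + length (filterᵇ P [ B ])        ≡⟨ cong (λ k → countBelow P B + k) (singleton (P B) refl) ⟩
  countBelow P B + bit (P B)                       ∎
  where
  open ≡-Reasoning
  singleton : ∀ b → P B ≡ b → length (filterᵇ P [ B ]) ≡ bit b
  singleton true  eq rewrite eq = refl
  singleton false eq rewrite eq = refl

DownClosed : (ℕ → Bool) → Set
DownClosed P = ∀ t → P (suc t) ≡ true → P t ≡ true

down-closed-≤ : ∀ {P} → DownClosed P → ∀ {s t} → s ≤ t → P t ≡ true → P s ≡ true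
down-closed-≤ closed {t = zero}  z≤n Pt = Pt
down-closed-≤ closed {t = suc t} s≤t Pt with m≤n⇒m<n∨m≡n s≤t
... | inj₁ (s≤s s≤t′) = down-closed-≤ closed s≤t′ (closed t Pt)
... | inj₂ refl       = Pt

countBelow-full : ∀ P B → (∀ t → t < B → P t ≡ true) → countBelow P B ≡ B
countBelow-full P zero    _   = refl
countBelow-full P (suc B) all = begin
  countBelow P (suc B)        ≡⟨ countBelow-suc P B ⟩
  countBelow P B + bit (P B)  ≡⟨ cong₂ _+_ (countBelow-full P B (λ t → all t ∘ m<n⇒m<1+n))
                                            (cong bit (all B (n<1+n B))) ⟩
  B + 1                       ≡⟨ +-comm B 1 ⟩
  suc B                       ∎
  where open ≡-Reasoning

threshold : ∀ P B → DownClosed P → (∀ t → P t ≡ true → t < B) →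
            ∀ t → P t ≡ (t <ᵇ countBelow P B)
threshold P zero _ bounded t = ¬-not (n≮0 ∘ bounded t)
threshold P (suc B) closed bounded t with P B in PB
... | true  = trans segment (cong (t <ᵇ_) (sym (countBelow-full P (suc B) below)))
  where
  below : ∀ s → s < suc B → P s ≡ true
  below s (s≤s s≤B) = down-closed-≤ closed s≤B PB
  segment : P t ≡ (t <ᵇ suc B)
  segment with t <? suc B
  ... | yes t<B = trans (below t t<B) (sym (<ᵇ-true t<B))
  ... | no  t≮B = trans (¬-not (t≮B ∘ bounded t)) (sym (<ᵇ-false (≮⇒≥ t≮B)))
... | false = trans (threshold P B closed bounded′ t) (cong (t <ᵇ_) (sym count))
  where
  bounded′ : ∀ s → P s ≡ true → s < B
  bounded′ s Ps with m≤n⇒m<n∨m≡n (bounded s Ps)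
  ... | inj₁ (s≤s s<B) = s<B
  ... | inj₂ refl      = contradiction (trans (sym Ps) PB) λ ()
  count : countBelow P (suc B) ≡ countBelow P B
  count = trans (countBelow-suc P B) (trans (cong (λ b → countBelow P B + bit b) PB)
                                            (+-identityʳ _))

threshold-unique : ∀ a b → (∀ t → (t <ᵇ a) ≡ (t <ᵇ b)) → a ≡ b
threshold-unique a b same = ≤-antisym (below a b same) (below b a (sym ∘ same))
  where
  below : ∀ a b → (∀ t → (t <ᵇ a) ≡ (t <ᵇ b)) → a ≤ b
  below a b same = ≮⇒≥ λ b<a →
    contradiction (trans (sym (<ᵇ-true b<a)) (trans (same b) (<ᵇ-false {b} ≤-refl))) λ ()

countBelow-segment : ∀ P B c → (∀ t → P t ≡ (t <ᵇ c)) → c ≤ B → countBelow P B ≡ c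
countBelow-segment P B c segment c≤B =
  threshold-unique _ _ λ t → trans (sym (threshold P B closed bounded t)) (segment t)
  where
  closed : DownClosed P
  closed t Pt+1 = trans (segment t)
    (<ᵇ-true (<⇒≤ (<ᵇ-sound {suc t} {c} (trans (sym (segment (suc t))) Pt+1))))
  bounded : ∀ t → P t ≡ true → t < B
  bounded t Pt = ≤-trans (<ᵇ-sound {t} {c} (trans (sym (segment t)) Pt)) c≤B

+[m+k]-+m : ∀ m k → + (m + k) ℤ.- + m ≡ + k
+[m+k]-+m m k = trans ([+m]-[+n]≡m⊖n (m + k) m) (trans (⊖-≥ (m≤m+n m k)) (cong +_ (m+n∸m≡n m k)))

zeros : ∀ {m} → Vec ℕ m
zeros = tabulate (λ _ → 0)

+-zeros : ∀ {m} (x : Vec ℕ m) → zipWith _+_ x zeros ≡ x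
+-zeros []       = refl
+-zeros (x ∷ xs) = cong₂ _∷_ (+-identityʳ x) (+-zeros xs)

+-∷ʳ : ∀ {m} (x y : Vec ℕ m) a b → zipWith _+_ (x ∷ʳ a) (y ∷ʳ b) ≡ zipWith _+_ x y ∷ʳ (a + b)
+-∷ʳ []       []       a b = refl
+-∷ʳ (x ∷ xs) (y ∷ ys) a b = cong (x + y ∷_) (+-∷ʳ xs ys a b)

init∷ʳlast : ∀ {m} (β : Vec ℕ (suc m)) → β ≡ init β ∷ʳ last β
init∷ʳlast β with initLast β
... | γ , t , eq = eq

-- A property that passes from b + e_i down to b passes from x + v down
-- to x for every v: walk down one unit step at a time, coordinate by
-- coordinate.
unit-steps⇒down : ∀ {m} (Q : Vec ℕ m → Set) → (∀ b i → Q (zipWith _+_ b (e i)) → Q b) →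
                  ∀ x v → Q (zipWith _+_ x v) → Q x
unit-steps⇒down Q step [] [] q = q
unit-steps⇒down Q step (x₀ ∷ x) (v₀ ∷ v) q =
  unit-steps⇒down (λ y → Q (x₀ ∷ y)) tail-step x v (head-down v₀ (zipWith _+_ x v) q)
  where
  head-down : ∀ j y → Q ((x₀ + j) ∷ y) → Q (x₀ ∷ y)
  head-down zero    y q = subst Q (cong (_∷ y) (+-identityʳ x₀)) q
  head-down (suc j) y q = head-down j y (step ((x₀ + j) ∷ y) Fin.zero
    (subst Q (cong₂ _∷_ (trans (+-suc x₀ j) (+-comm 1 (x₀ + j))) (sym (+-zeros y))) q))
  tail-step : ∀ b i → Q (x₀ ∷ zipWith _+_ b (e i)) → Q (x₀ ∷ b)
  tail-step b i q = step (x₀ ∷ b) (Fin.suc i)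
    (subst Q (cong (_∷ zipWith _+_ b (e i)) (sym (+-identityʳ x₀))) q)

-- Standard sets

standard-down : ∀ {d} {S : Subset d} → IsStandard S →
                ∀ x v → S (zipWith _+_ x v) ≡ true → S x ≡ true
standard-down standard x v x+v∈S =
  ¬-not λ x∉S → contradiction (trans (sym x+v∈S) (standard x v x∉S)) λ ()

down⇒standard : ∀ {d} {S : Subset d} →
                (∀ x v → S (zipWith _+_ x v) ≡ true → S x ≡ true) → IsStandard S
down⇒standard down x v x∉S =
  ¬-not λ x+v∈S → contradiction (trans (sym (down x v x+v∈S)) x∉S) λ ()

bit-standard : ∀ {d} {S : Subset d} → IsStandard S →
               ∀ x v → bit (S (zipWith _+_ x v)) ≤ bit (S x)
bit-standard {S = S} standard x v with S x in x∈S
... | true  = bit≤1 _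
... | false rewrite standard x v x∈S = z≤n

last-bounded : ∀ {m} {x : Vec ℕ (suc m)} xs → x ∈ xs → last x ≤ foldr (λ y k → last y ⊔ k) 0 xs
last-bounded (y ∷ ys) (here refl) = m≤m⊔n (last y) _
last-bounded (y ∷ ys) (there x∈ys) = ≤-trans (last-bounded ys x∈ys) (m≤n⊔m (last y) _)

module Fibres {m} (Δ : FinStdSet (suc m)) where

  column : Vec ℕ m → ℕ → Bool
  column γ t = mem (fin Δ) (γ ∷ʳ t)

  column-closed : ∀ γ → DownClosed (column γ)
  column-closed γ t =
    standard-down (standard Δ) (γ ∷ʳ t) (zeros ∷ʳ 1) ∘ subst (λ x → mem (fin Δ) x ≡ true) (sym up)
    where
    up : zipWith _+_ (γ ∷ʳ t) (zeros ∷ʳ 1) ≡ γ ∷ʳ suc t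
    up = trans (+-∷ʳ γ zeros t 1) (cong₂ _∷ʳ_ (+-zeros γ) (+-comm t 1))

  column-bounded : ∀ γ t → column γ t ≡ true → t < suc (foldr (λ y k → last y ⊔ k) 0 (cover (fin Δ)))
  column-bounded γ t γt∈Δ = s≤s (subst (_≤ _) (last-∷ʳ t γ)
    (last-bounded _ (covers (fin Δ) (γ ∷ʳ t) (Equivalence.from T-≡ γt∈Δ))))

  fibre : ∀ γ t → mem (fin Δ) (γ ∷ʳ t) ≡ (t <ᵇ h (fin Δ) γ)
  fibre γ = threshold (column γ) _ (column-closed γ) (column-bounded γ)

  membership : ∀ β → mem (fin Δ) β ≡ (last β <ᵇ h (fin Δ) (init β))
  membership β = trans (cong (mem (fin Δ)) (init∷ʳlast β)) (fibre (init β) (last β))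

hEmbed-bit : ∀ {m} (D : FinStdSet m) γ → hEmbed D γ ≡ bit (mem (fin D) γ)
hEmbed-bit D γ = countBelow-segment _ _ _ column (≤-trans (bit≤1 _) (s≤s z≤n))
  where
  column : ∀ t → embedMem (mem (fin D)) (γ ∷ʳ t) ≡ (t <ᵇ bit (mem (fin D) γ))
  column t rewrite init-∷ʳ t γ | last-∷ʳ t γ with mem (fin D) γ | t
  ... | true  | zero  = refl
  ... | true  | suc _ = refl
  ... | false | _     = refl

-- Turning a list whose entries all satisfy P into a list of B's,
-- entry by entry, preserves pointwise relatedness and permutations,
-- provided P and the construction respect the equivalence.
module Reduce {a ℓ b r p} (S : Setoid a ℓ) {B : Set b} (_∼_ : Rel B r)
               {P : Pred (Setoid.Carrier S) p} (P-resp : P Respects Setoid._≈_ S)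
               (f : ∀ {x} → P x → B)
               (f-resp : ∀ {x y} (px : P x) (py : P y) → Setoid._≈_ S x y → f px ∼ f py) where
  open Setoid S using (_≈_)
  open PermProperties S using (All-resp-↭)

  reduce-pointwise : ∀ {xs ys} → Pointwise _≈_ xs ys → (pxs : All P xs) (pys : All P ys) →
                     Pointwise _∼_ (reduce f pxs) (reduce f pys)
  reduce-pointwise []            []         []         = []
  reduce-pointwise (x≈y ∷ xs≈ys) (px ∷ pxs) (py ∷ pys) = f-resp px py x≈y ∷ reduce-pointwise xs≈ys pxs pys

  reduce-↭ : ∀ {xs ys} → Permutation _≈_ xs ys → (pxs : All P xs) (pys : All P ys) →
             Permutation _∼_ (reduce f pxs) (reduce f pys)
  reduce-↭ (Perm.refl xs≈ys) pxs pys = Perm.refl (reduce-pointwise xs≈ys pxs pys)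
  reduce-↭ (Perm.prep x≈y xs↭ys) (px ∷ pxs) (py ∷ pys) = Perm.prep (f-resp px py x≈y) (reduce-↭ xs↭ys pxs pys)
  reduce-↭ (Perm.swap x≈x′ y≈y′ xs↭ys) (px ∷ py ∷ pxs) (py′ ∷ px′ ∷ pys) =
    Perm.swap (f-resp px px′ x≈x′) (f-resp py py′ y≈y′) (reduce-↭ xs↭ys pxs pys)
  reduce-↭ (Perm.trans xs↭zs zs↭ys) pxs pys =
    Perm.trans (reduce-↭ xs↭zs pxs pzs) (reduce-↭ zs↭ys pzs pys)
    where pzs = All-resp-↭ P-resp xs↭zs pxs

FinStdSetoid : ℕ → Setoid _ _
FinStdSetoid n = record
  { Carrier       = FinStdSet n
  ; _≈_           = _≈S_
  ; isEquivalence = record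
    { refl  = λ _ → refl
    ; sym   = λ D≈E x → sym (D≈E x)
    ; trans = λ D≈E E≈F x → trans (D≈E x) (E≈F x)
    }
  }

-- C4 sums as multiplicities

multiplicity : ∀ {n} → List (FinStdSet n) → Vec ℕ n → ℕ
multiplicity Ds γ = sumℕ (map (λ D → bit (mem (fin D) γ)) Ds)

-- Since an embedded set has height 1 exactly over its points, the C4 sum
-- of Ds is the region below the graph of multiplicity Ds.
c4Sum-multiplicity : ∀ {n} Ds (β : Vec ℕ (suc n)) →
                     c4SumMem Ds β ≡ (last β <ᵇ multiplicity Ds (init β))
c4Sum-multiplicity Ds β = cong (last β <ᵇ_) (heights Ds)
  where
  heights : ∀ Ds → sumℕ (map (λ D → hEmbed D (init β)) Ds) ≡ multiplicity Ds (init β)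
  heights []       = refl
  heights (D ∷ Ds) = cong₂ _+_ (hEmbed-bit D (init β)) (heights Ds)

multiplicity-─ : ∀ {n} {D : FinStdSet n} Ds (D∈Ds : D ∈ Ds) γ →
                 multiplicity Ds γ ≡ bit (mem (fin D) γ) + multiplicity (Ds ─ D∈Ds) γ
multiplicity-─ (D ∷ Ds) (here refl)  γ = refl
multiplicity-─ {D = D} (E ∷ Ds) (there D∈Ds) γ =
  trans (cong (λ k → bit (mem (fin E) γ) + k) (multiplicity-─ Ds D∈Ds γ))
        (x∙yz≈y∙xz +-commutativeSemigroup (bit (mem (fin E) γ)) (bit (mem (fin D) γ)) _)

multiplicity-standard : ∀ {n} (Ds : List (FinStdSet n)) x v →
                        multiplicity Ds (zipWith _+_ x v) ≤ multiplicity Ds x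
multiplicity-standard []       x v = z≤n
multiplicity-standard (D ∷ Ds) x v =
  +-mono-≤ (bit-standard (standard D) x v) (multiplicity-standard Ds x v)

-- The correspondence for a fixed finite standard set Δ ⊆ ℕ^(n+1)

module Correspondence {n} (Δ : FinStdSet (suc n)) where
  open Fibres Δ using (fibre; membership)

  decomposition⇒height : ∀ Ds → (∀ β → mem (fin Δ) β ≡ c4SumMem Ds β) →
                         ∀ γ → h (fin Δ) γ ≡ multiplicity Ds γ
  decomposition⇒height Ds sum γ = threshold-unique _ _ λ t → begin
    t <ᵇ h (fin Δ) γ                                  ≡⟨ sym (fibre γ t) ⟩
    mem (fin Δ) (γ ∷ʳ t)                              ≡⟨ sum (γ ∷ʳ t) ⟩
    c4SumMem Ds (γ ∷ʳ t)                              ≡⟨ c4Sum-multiplicity Ds (γ ∷ʳ t) ⟩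
    last (γ ∷ʳ t) <ᵇ multiplicity Ds (init (γ ∷ʳ t))  ≡⟨ cong₂ (λ s ζ → s <ᵇ multiplicity Ds ζ)
                                                               (last-∷ʳ t γ) (init-∷ʳ t γ) ⟩
    t <ᵇ multiplicity Ds γ                            ∎
    where open ≡-Reasoning

  height⇒decomposition : ∀ Ds → (∀ γ → h (fin Δ) γ ≡ multiplicity Ds γ) →
                         ∀ β → mem (fin Δ) β ≡ c4SumMem Ds β
  height⇒decomposition Ds height β =
    trans (membership β) (trans (cong (last β <ᵇ_) (height (init β))) (sym (c4Sum-multiplicity Ds β)))

  -- γ is a node of G(Δ) iff (γ, 0) ∈ Δ iff h_Δ(γ) > 0.
  isNode : Vec ℕ n → Bool
  isNode γ = mem (fin Δ) (γ ∷ʳ 0)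

  node-intro : ∀ {γ} → isNode γ ≡ true → Node Δ γ
  node-intro {γ} γ0∈Δ = (γ ∷ʳ 0) , Equivalence.from T-≡ γ0∈Δ , init-∷ʳ 0 γ

  node-positive : ∀ γ → 0 < h (fin Δ) γ → isNode γ ≡ true
  node-positive γ 0<h = trans (fibre γ 0) (<ᵇ-true 0<h)

  node-elim : ∀ {γ} → Node Δ γ → isNode γ ≡ true
  node-elim (β , β∈Δ , refl) =
    node-positive (init β)
      (≤-trans (s≤s z≤n) (<ᵇ-sound (trans (sym (membership β)) (Equivalence.to T-≡ β∈Δ))))

  off-node-height : ∀ {γ} → isNode γ ≡ false → h (fin Δ) γ ≡ 0
  off-node-height {γ} γ0∉Δ with h (fin Δ) γ | trans (sym (fibre γ 0)) γ0∉Δ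
  ... | zero  | _  = refl
  ... | suc _ | ()

  node-down : ∀ b i → isNode (zipWith _+_ b (e i)) ≡ true → isNode b ≡ true
  node-down b i = standard-down (standard Δ) (b ∷ʳ 0) (e i ∷ʳ 0)
                ∘ subst (λ x → mem (fin Δ) x ≡ true) (sym (+-∷ʳ b (e i) 0 0))

  monotone⇒standard : ∀ (ℓ : Labels Δ) (f : Vec ℕ n → ℕ) → (∀ γ → ℓ γ ≡ + f γ) →
                      (∀ b i → f (zipWith _+_ b (e i)) ≤ f b) → IsStandardGraph Δ ℓ
  monotone⇒standard ℓ f ℓ≡f mono =
    (λ a _ → subst (+0 ℤ≤_) (sym (ℓ≡f a)) (+≤+ z≤n)) ,
    λ { a b (_ , _ , i , refl) → subst₂ _ℤ≤_ (sym (ℓ≡f a)) (sym (ℓ≡f b)) (+≤+ (mono b i)) }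

  standard-resp : ∀ {ℓ ℓ′ : Labels Δ} → (∀ γ → ℓ γ ≡ ℓ′ γ) →
                  IsStandardGraph Δ ℓ → IsStandardGraph Δ ℓ′
  standard-resp ℓ≡ℓ′ (nonneg , mono) =
    (λ a a∈ → subst (+0 ℤ≤_) (ℓ≡ℓ′ a) (nonneg a a∈)) ,
    (λ a b ab → subst₂ _ℤ≤_ (ℓ≡ℓ′ a) (ℓ≡ℓ′ b) (mono a b ab))

  component-resp : ∀ {ℓ ℓ′ : Labels Δ} → (∀ γ → ℓ γ ≡ ℓ′ γ) →
                   IsStdComponent Δ ℓ → IsStdComponent Δ ℓ′
  component-resp ℓ≡ℓ′ (binary , std , co-std , (a , a∈ , ℓa≢0)) =
    (λ a a∈ → subst (λ z → z ≡ +0 ⊎ z ≡ + 1) (ℓ≡ℓ′ a) (binary a a∈)) ,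
    standard-resp ℓ≡ℓ′ std ,
    standard-resp (λ γ → cong (λ z → GΔ Δ γ ℤ.- z) (ℓ≡ℓ′ γ)) co-std ,
    (a , a∈ , ℓa≢0 ∘ trans (ℓ≡ℓ′ a))

  indicator-bit : ∀ D γ → indicator Δ D γ ≡ + bit (mem (fin D) γ)
  indicator-bit D γ with mem (fin D) γ
  ... | true  = refl
  ... | false = refl

  indicator-resp : ∀ {D D′} → D ≈S D′ → ∀ γ → indicator Δ D γ ≡ indicator Δ D′ γ
  indicator-resp D≈D′ γ = cong (λ b → if b then + 1 else +0) (D≈D′ γ)

  module Parts (Ds : List (FinStdSet n)) (sum : ∀ β → mem (fin Δ) β ≡ c4SumMem Ds β) where
    height : ∀ γ → h (fin Δ) γ ≡ multiplicity Ds γ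
    height = decomposition⇒height Ds sum

    part⊆nodes : ∀ {D} → D ∈ Ds → ∀ γ → mem (fin D) γ ≡ true → isNode γ ≡ true
    part⊆nodes D∈Ds γ γ∈D = node-positive γ
      (subst (0 <_) (sym (trans (height γ) (multiplicity-─ Ds D∈Ds γ)))
                    (subst (λ b → 0 < bit b + multiplicity (Ds ─ D∈Ds) γ) (sym γ∈D) (s≤s z≤n)))

    remainder : ∀ {D} (D∈Ds : D ∈ Ds) γ →
                _⊖_ Δ (GΔ Δ) (indicator Δ D) γ ≡ + multiplicity (Ds ─ D∈Ds) γ
    remainder {D} D∈Ds γ = begin
      + h (fin Δ) γ ℤ.- indicator Δ D γ
        ≡⟨ cong₂ (λ k z → + k ℤ.- z) (trans (height γ) (multiplicity-─ Ds D∈Ds γ)) (indicator-bit D γ) ⟩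
      + (bit (mem (fin D) γ) + multiplicity (Ds ─ D∈Ds) γ) ℤ.- + bit (mem (fin D) γ)
        ≡⟨ +[m+k]-+m (bit (mem (fin D) γ)) _ ⟩
      + multiplicity (Ds ─ D∈Ds) γ
        ∎
      where open ≡-Reasoning

    part-component : ∀ {D} → D ∈ Ds → NonEmpty D → IsStdComponent Δ (indicator Δ D)
    part-component {D} D∈Ds (x , x∈D) =
      (λ γ _ → binary γ) ,
      monotone⇒standard _ _ (indicator-bit D) (λ b i → bit-standard (standard D) b (e i)) ,
      monotone⇒standard _ _ (remainder D∈Ds) (λ b i → multiplicity-standard (Ds ─ D∈Ds) b (e i)) ,
      (x , node-intro (part⊆nodes D∈Ds x x∈D′) ,
       subst (λ z → z ≢ +0) (sym (indicator-bit D x)) (subst (λ b → + bit b ≢ +0) (sym x∈D′) λ ()))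
      where
      x∈D′ : mem (fin D) x ≡ true
      x∈D′ = Equivalence.to T-≡ x∈D
      binary : ∀ γ → indicator Δ D γ ≡ +0 ⊎ indicator Δ D γ ≡ + 1
      binary γ with mem (fin D) γ
      ... | true  = inj₂ refl
      ... | false = inj₁ refl

  IndicatorComponent : FinStdSet n → Set
  IndicatorComponent D = IsStdComponent Δ (indicator Δ D)

  toComponent : ∀ {D} → IndicatorComponent D → StdComponent Δ
  toComponent {D} c = indicator Δ D , c

  components : ∀ {Ds} → All IndicatorComponent Ds → List (StdComponent Δ)
  components = reduce (λ {D} → toComponent {D})

  part-components : (A : C4Dec Δ) → All IndicatorComponent (parts A)
  part-components A =
    All.tabulate λ D∈ → Parts.part-component (parts A) (sumIsΔ A) D∈ (nonempty A _ D∈)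

  label-sum : ∀ {Ds} (cs : All IndicatorComponent Ds) γ →
              sumℤ Δ (map (λ H → proj₁ H γ) (components cs)) ≡ + multiplicity Ds γ
  label-sum []                    γ = refl
  label-sum {D ∷ Ds} (c ∷ cs) γ =
    trans (cong₂ ℤ._+_ (indicator-bit D γ) (label-sum cs γ)) (sym (pos-+ (bit (mem (fin D) γ)) _))

  Φ : C4Dec Δ → StdDec Δ
  Φ A = record
    { comps  = components (part-components A)
    ; sumIsG = λ γ _ → trans (label-sum (part-components A) γ)
                             (cong +_ (sym (decomposition⇒height (parts A) (sumIsΔ A) γ)))
    }

  Φ-canonical : IsCanonical Δ Φ
  Φ-canonical A = labels (part-components A)
    where
    labels : ∀ {Ds} (cs : All IndicatorComponent Ds) →
             Pointwise (_≈L_ Δ) (map proj₁ (components cs)) (map (indicator Δ) Ds)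
    labels []       = []
    labels (c ∷ cs) = (λ _ _ → refl) ∷ labels cs

  open Reduce (FinStdSetoid n) (_≈SC_ Δ)
              (λ {D} {D′} D≈D′ → component-resp (indicator-resp {D} {D′} D≈D′))
              (λ {D} → toComponent {D})
              (λ {D} {D′} _ _ D≈D′ γ _ → indicator-resp {D} {D′} D≈D′ γ)
              using (reduce-↭)

  Φ-resp : ∀ A B → A ≈C4 B → _≈SD_ Δ (Φ A) (Φ B)
  Φ-resp A B A↭B = reduce-↭ A↭B (part-components A) (part-components B)

  isOne : ℤ → Bool
  isOne (+ 1) = true
  isOne _     = false

  component-bit : ∀ (H : StdComponent Δ) γ → Node Δ γ → proj₁ H γ ≡ + bit (isOne (proj₁ H γ))
  component-bit (ℓ , binary , _) γ γ∈ with binary γ γ∈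
  ... | inj₁ ℓγ≡0 rewrite ℓγ≡0 = refl
  ... | inj₂ ℓγ≡1 rewrite ℓγ≡1 = refl

  nonzero⇒one : ∀ {z} → z ≡ +0 ⊎ z ≡ + 1 → z ≢ +0 → isOne z ≡ true
  nonzero⇒one (inj₁ z≡0) z≢0 = contradiction z≡0 z≢0
  nonzero⇒one (inj₂ z≡1) _   = cong isOne z≡1

  supportMem : StdComponent Δ → Subset n
  supportMem H γ = isNode γ ∧ isOne (proj₁ H γ)

  -- Supports go down along unit steps: nodes do, and labels do not
  -- increase along the edges of G(Δ).
  support-step : ∀ H b i → supportMem H (zipWith _+_ b (e i)) ≡ true → supportMem H b ≡ true
  support-step H@(ℓ , binary , (_ , mono) , _) b i b+eᵢ∈
    with (b+eᵢ-node , b+eᵢ-one) ← ∧-true {isNode (zipWith _+_ b (e i))} b+eᵢ∈ =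
    cong₂ _∧_ b-node (nonzero⇒one (binary b (node-intro b-node)) λ ℓb≡0 →
      contradiction (subst (+ 1 ℤ≤_) ℓb≡0 below) λ { (+≤+ ()) })
    where
    b-node = node-down b i b+eᵢ-node
    below : + 1 ℤ≤ ℓ b
    below = subst (_ℤ≤ ℓ b)
      (trans (component-bit H _ (node-intro b+eᵢ-node)) (cong (λ o → + bit o) b+eᵢ-one))
      (mono _ b (node-intro b+eᵢ-node , node-intro b-node , i , refl))

  -- The support is finite (it consists of nodes) and standard (by support-step).
  support : StdComponent Δ → FinStdSet n
  support H = record
    { fin      = record { mem = supportMem H ; cover = map init (cover (fin Δ)) ; covers = covered }
    ; standard = down⇒standard (unit-steps⇒down (λ y → supportMem H y ≡ true) (support-step H))
    }
    where
    covered : ∀ γ → T (supportMem H γ) → γ ∈ map init (cover (fin Δ))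
    covered γ γ∈ = subst (_∈ map init (cover (fin Δ))) (init-∷ʳ 0 γ)
      (∈-map⁺ init (covers (fin Δ) (γ ∷ʳ 0) γ0∈Δ))
      where
      γ0∈Δ : T (isNode γ)
      γ0∈Δ = Equivalence.from T-≡ (proj₁ (∧-true (Equivalence.to T-≡ γ∈)))

  support-nonempty : ∀ H → NonEmpty (support H)
  support-nonempty (ℓ , binary , _ , _ , (a , a∈ , ℓa≢0)) =
    a , Equivalence.from T-≡ (cong₂ _∧_ (node-elim a∈) (nonzero⇒one (binary a a∈) ℓa≢0))

  support-resp : ∀ {H H′} → _≈SC_ Δ H H′ → support H ≈S support H′
  support-resp H≈H′ γ with isNode γ in γ-node
  ... | false = refl
  ... | true  = cong isOne (H≈H′ γ (node-intro γ-node))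

  indicator-support : ∀ H γ → Node Δ γ → indicator Δ (support H) γ ≡ proj₁ H γ
  indicator-support H γ γ∈ = begin
    indicator Δ (support H) γ                ≡⟨ indicator-bit (support H) γ ⟩
    + bit (isNode γ ∧ isOne (proj₁ H γ))     ≡⟨ cong (λ b → + bit (b ∧ isOne (proj₁ H γ))) (node-elim γ∈) ⟩
    + bit (isOne (proj₁ H γ))                ≡⟨ sym (component-bit H γ γ∈) ⟩
    proj₁ H γ                                ∎
    where open ≡-Reasoning

  support-indicator : ∀ {D} (c : IndicatorComponent D) →
                      (∀ γ → mem (fin D) γ ≡ true → isNode γ ≡ true) →
                      support (toComponent {D} c) ≈S D
  support-indicator {D} c D⊆nodes γ with mem (fin D) γ in γ∈D
  ... | true  rewrite D⊆nodes γ γ∈D = refl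
  ... | false = ∧-zeroʳ (isNode γ)

  multiplicity-supports : ∀ Hs γ → Node Δ γ →
                          + multiplicity (map support Hs) γ ≡ sumℤ Δ (map (λ H → proj₁ H γ) Hs)
  multiplicity-supports []       γ γ∈ = refl
  multiplicity-supports (H ∷ Hs) γ γ∈ =
    trans (pos-+ (bit (supportMem H γ)) _)
          (cong₂ ℤ._+_ (trans (sym (indicator-bit (support H) γ)) (indicator-support H γ γ∈))
                       (multiplicity-supports Hs γ γ∈))

  multiplicity-off-nodes : ∀ Hs γ → isNode γ ≡ false → multiplicity (map support Hs) γ ≡ 0
  multiplicity-off-nodes []       γ γ∉ = refl
  multiplicity-off-nodes (H ∷ Hs) γ γ∉ rewrite γ∉ = multiplicity-off-nodes Hs γ γ∉

  supports-height : (E : StdDec Δ) → ∀ γ → h (fin Δ) γ ≡ multiplicity (map support (comps E)) γ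
  supports-height E γ = by-node (isNode γ) refl
    where
    by-node : ∀ b → isNode γ ≡ b → h (fin Δ) γ ≡ multiplicity (map support (comps E)) γ
    by-node true  γ-node = +-injective (trans (sym (sumIsG E γ (node-intro γ-node)))
                                              (sym (multiplicity-supports (comps E) γ (node-intro γ-node))))
    by-node false γ∉     = trans (off-node-height γ∉) (sym (multiplicity-off-nodes (comps E) γ γ∉))

  Ψ : StdDec Δ → C4Dec Δ
  Ψ E = record
    { parts    = map support (comps E)
    ; nonempty = λ D D∈ → let (H , _ , D≡) = ∈-map⁻ support D∈
                          in subst NonEmpty (sym D≡) (support-nonempty H)
    ; sumIsΔ   = height⇒decomposition (map support (comps E)) (supports-height E)
    }

  Φ-Ψ : ∀ E → _≈SD_ Δ (Φ (Ψ E)) E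
  Φ-Ψ E = Perm.refl (indicators-of-supports (comps E) (part-components (Ψ E)))
    where
    indicators-of-supports : ∀ Hs (cs : All IndicatorComponent (map support Hs)) →
                             Pointwise (_≈SC_ Δ) (components cs) Hs
    indicators-of-supports []       []       = []
    indicators-of-supports (H ∷ Hs) (c ∷ cs) = indicator-support H ∷ indicators-of-supports Hs cs

  Ψ-Φ : ∀ A → Pointwise _≈S_ (parts (Ψ (Φ A))) (parts A)
  Ψ-Φ A = supports-of-indicators (part-components A) (Parts.part⊆nodes (parts A) (sumIsΔ A))
    where
    supports-of-indicators : ∀ {Ds} (cs : All IndicatorComponent Ds) →
                             (∀ {D} → D ∈ Ds → ∀ γ → mem (fin D) γ ≡ true → isNode γ ≡ true) →
                             Pointwise _≈S_ (map support (components cs)) Ds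
    supports-of-indicators []       _        = []
    supports-of-indicators {D ∷ Ds} (c ∷ cs) ⊆nodes =
      support-indicator {D} c (⊆nodes (here refl)) ∷ supports-of-indicators cs (⊆nodes ∘ there)

  ComponentSetoid : Setoid _ _
  ComponentSetoid = record
    { Carrier       = StdComponent Δ
    ; _≈_           = _≈SC_ Δ
    ; isEquivalence = record
      { refl  = λ _ _ → refl
      ; sym   = λ H≈H′ a a∈ → sym (H≈H′ a a∈)
      ; trans = λ H≈H′ H′≈H″ a a∈ → trans (H≈H′ a a∈) (H′≈H″ a a∈)
      }
    }

  Ψ-resp : ∀ E E′ → _≈SD_ Δ E E′ → Ψ E ≈C4 Ψ E′
  Ψ-resp E E′ =
    PermProperties.map⁺ ComponentSetoid (FinStdSetoid n) (λ {H} {H′} → support-resp {H} {H′})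

  -- Φ is injective on multisets: A ≈ Ψ (Φ A) ≈ Ψ (Φ B) ≈ B.
  Φ-injective : ∀ A B → _≈SD_ Δ (Φ A) (Φ B) → A ≈C4 B
  Φ-injective A B ΦA≈ΦB =
    Perm.trans (Perm.refl (Pointwise.symmetric (λ {D} {D′} → Setoid.sym (FinStdSetoid n) {D} {D′}) (Ψ-Φ A)))
               (Perm.trans (Ψ-resp (Φ A) (Φ B) ΦA≈ΦB) (Perm.refl (Ψ-Φ B)))

proposition6p4 : ∀ (n : ℕ) (Δ : FinStdSet (suc n)) →
    Σ (C4Dec Δ → StdDec Δ) λ Φ →
      IsCanonical Δ Φ
      × (∀ A B → A ≈C4 B → _≈SD_ Δ (Φ A) (Φ B))
      × (∀ A B → _≈SD_ Δ (Φ A) (Φ B) → A ≈C4 B)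
      × (∀ E → ∃ λ A → _≈SD_ Δ (Φ A) E)
proposition6p4 n Δ = Φ , Φ-canonical , Φ-resp , Φ-injective , λ E → Ψ E , Φ-Ψ E
  where open Correspondence Δ
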